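{- Let $k$ be a positive integer. For integers $q\ge 2$ define \[ F_k(q) = \min \{ |kA| : A\subset \mathbb{Z}_q,\ A-A = \mathbb{Z}_q \}, \] \[ G_k(q) = \min \{ |kA| : A\subset \mathbb{Z} \text{ finite},\ A-A \supset \{a+1, \ldots, a+q \} \text{ for some integer } a \}, \] \[ H_k(q) = \min \{ |kA| : A\subset \mathbb{Z} \text{ finite},\ |A-A| \geq q \}. \] Let $q_1,q_2\ge 2$ be integers and $q=q_1q_2$. Then: (i) if $\gcd(q_1,q_2)=1$, then $F_k(q) \leq F_k(q_1) F_k(q_2)$; (ii) $G_k(q) \leq G_k(q_1) G_k(q_2)$; (iii) $H_k(q) \leq H_k(q_1) H_k(q_2)$.
   Context: $\mathbb{Z}_q$ denotes the group of residues modulo $q$. For a set $A$ in an abelian group, $kA = A+\cdots+A$ ($k$ times) is the set of all sums of $k$ elements of $A$, and $A-A=\{a-b: a,b\in A\}$. -}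

module Defs where

open import Data.Nat as ℕ using (ℕ; zero; suc; _≤_; _∸_)
open import Data.Nat.DivMod using (_mod_)
open import Data.Fin as Fin using (Fin; toℕ)
open import Data.Integer as ℤ using (ℤ)
open import Data.List using (List; []; _∷_; map; concatMap; length; deduplicate)
open import Data.List.Membership.Propositional using (_∈_)
open import Data.Product using (Σ; ∃; _×_; _,_)
open import Data.Empty using (⊥)
open import Relation.Binary.PropositionalEquality using (_≡_)
open import Relation.Binary.Definitions using (DecidableEquality)

IsLeast : (ℕ → Set) → ℕ → Set
IsLeast P m = P m × (∀ n → P n → m ≤ n)

-- A finite set is represented by a list of its elements (duplicates allowed).
-- Number of distinct elements of a list.
card : {X : Set} → DecidableEquality X → List X → ℕ
card _≟_ xs = length (deduplicate _≟_ xs)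

sums : {X : Set} → X → (X → X → X) → ℕ → List X → List X
sums z _⊕_ zero A = z ∷ []
sums z _⊕_ (suc k) A = concatMap (λ a → map (a ⊕_) (sums z _⊕_ k A)) A

diffs : {X : Set} → (X → X → X) → List X → List X
diffs _⊖_ A = concatMap (λ a → map (a ⊖_) A) A

-- Arithmetic in ℤ_q for q = suc n, elements represented by Fin (suc n)
module ZMod (n : ℕ) where
  _+q_ : Fin (suc n) → Fin (suc n) → Fin (suc n)
  x +q y = (toℕ x ℕ.+ toℕ y) mod suc n

  _-q_ : Fin (suc n) → Fin (suc n) → Fin (suc n)
  x -q y = (toℕ x ℕ.+ (suc n ∸ toℕ y)) mod suc n

F-attains : ℕ → ℕ → ℕ → Set
F-attains k zero m = ⊥
F-attains k (suc n) m =
  Σ (List (Fin (suc n))) λ A →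
    (∀ (z : Fin (suc n)) → z ∈ diffs _-q_ A) × card Fin._≟_ (sums Fin.zero _+q_ k A) ≡ m
  where open ZMod n

IsF : ℕ → ℕ → ℕ → Set
IsF k q = IsLeast (F-attains k q)

G-attains : ℕ → ℕ → ℕ → Set
G-attains k q m =
  Σ (List ℤ) λ A →
    (∃ λ (a : ℤ) → ∀ (i : ℕ) → 1 ≤ i → i ≤ q → a ℤ.+ ℤ.+ i ∈ diffs ℤ._-_ A)
    × card ℤ._≟_ (sums (ℤ.+ 0) ℤ._+_ k A) ≡ m

IsG : ℕ → ℕ → ℕ → Set
IsG k q = IsLeast (G-attains k q)

H-attains : ℕ → ℕ → ℕ → Set
H-attains k q m =
  Σ (List ℤ) λ A →
    q ≤ card ℤ._≟_ (diffs ℤ._-_ A) × card ℤ._≟_ (sums (ℤ.+ 0) ℤ._+_ k A) ≡ m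

IsH : ℕ → ℕ → ℕ → Set
IsH k q = IsLeast (H-attains k q)

-- One construction drives all three parts.  If g : X → Y → Z is additive
-- (g 0 0 = 0, g (x + x') (y + y') = g x y + g x' y'), then A = g(A₁ × A₂)
-- satisfies kA ⊆ g(kA₁ × kA₂), so |kA| ≤ |kA₁| · |kA₂|; and if g preserves
-- differences, g((A₁ − A₁) × (A₂ − A₂)) ⊆ A − A.  So A is admissible for q₁q₂
-- whenever A₁, A₂ are for q₁, q₂, and minima are submultiplicative.
-- The parts differ only in g and in why A − A is large:
--   (i)   g x y = x q₂ + y q₁ in ℤ_{q₁q₂}, surjective by Bézout if gcd = 1;
--   (ii)  g x y = x + q₁ y in ℤ, sending two intervals of lengths q₁, q₂
--         onto one of length q₁q₂ (base-q₁ digits);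
--   (iii) g x y = x + M y in ℤ, M > 2 max |A₁ − A₁|, injective on
--         (A₁ − A₁) × ℤ, so |A − A| ≥ |A₁ − A₁| · |A₂ − A₂|.
module Submission where

open import Defs
open import Data.Nat using (ℕ; _≤_; _*_)
open import Data.Nat.GCD using (gcd)
open import Data.Product using (_×_)
open import Relation.Binary.PropositionalEquality using (_≡_)

open import Data.Nat using (zero; suc; _+_; _∸_; _<_; z≤n; s≤s; NonZero)
open import Data.Nat.Properties using (≤-trans; *-mono-≤; +-mono-≤; *-comm; +-assoc; *-identityʳ; m∸n+n≡m; m+[n∸m]≡n; m≤m+n; m≤n+m; m≤m*n; n<1+n; <⇒≱)
open import Data.Nat.DivMod using (_%_; _/_; _mod_; m%n<n; m<n*o⇒m/o<n; m≡m%n+[m/n]*n; %-distribˡ-+; %-distribˡ-*; %-congʳ; m%n%n≡m%n; [m+n]%n≡m%n; [m+kn]%n≡m%n; m<n⇒m%n≡m; m%n*o≡m*o%[n*o])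
open import Data.Nat.Coprimality using (coprime-Bézout; gcd≡1⇒coprime)
open import Data.Nat.GCD using (module Bézout)
import Data.Nat.Tactic.RingSolver as ℕ-Solver
open import Data.Fin as Fin using (Fin; toℕ)
open import Data.Fin.Properties using (toℕ-injective; toℕ-fromℕ<; toℕ<n; toℕ≤n)
open import Data.Integer as ℤ using (ℤ; +_; ∣_∣)
open import Data.Integer.Properties using (pos-+; pos-*; ∣i-j∣≤∣i∣+∣j∣; ∣i*j∣≡∣i∣*∣j∣; ∣i∣≡0⇒i≡0; i-j≡0⇒i≡j; +-0-abelianGroup)
import Data.Integer.Tactic.RingSolver as ℤ-Solver
open import Algebra.Bundles using (AbelianGroup)
open import Algebra.Properties.Group (AbelianGroup.group +-0-abelianGroup) using (∙-cancelʳ)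
open import Data.List using (List; []; _∷_; map; concatMap; length; deduplicate; _++_; cartesianProductWith; cartesianProduct)
open import Data.Nat.ListAction using (sum)
open import Data.List.Properties using (length-++; length-map)
open import Data.List.Membership.Propositional using (_∈_)
open import Data.List.Membership.Propositional.Properties using (∈-map⁻; ∈-cartesianProductWith⁺; ∈-cartesianProductWith⁻; ∈-cartesianProduct⁻; ∈-deduplicate⁺; ∈-deduplicate⁻)
open import Data.List.Relation.Binary.Subset.Propositional using (_⊆_)
open import Data.List.Relation.Unary.Any using (here; there)
import Data.List.Relation.Unary.All as All
import Data.List.Relation.Unary.All.Properties as All
open import Data.List.Relation.Unary.AllPairs using ([]; _∷_)
open import Data.List.Relation.Unary.Unique.Propositional using (Unique)
import Data.List.Relation.Unary.Unique.Propositional.Properties as Unique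
open import Data.List.Relation.Unary.Unique.DecPropositional.Properties using (deduplicate-!)
open import Data.Product using (∃₂; ∃-syntax; _,_; uncurry)
open import Data.Empty using (⊥-elim)
open import Relation.Binary.PropositionalEquality using (_≢_; refl; sym; trans; cong; cong₂; subst; module ≡-Reasoning)
open import Relation.Binary.Definitions using (DecidableEquality)

least-submultiplicative : {P P₁ P₂ : ℕ → Set} →
  (∀ {m₁ m₂} → P₁ m₁ → P₂ m₂ → ∃[ m ] P m × m ≤ m₁ * m₂) →
  ∀ {m m₁ m₂} → IsLeast P m → IsLeast P₁ m₁ → IsLeast P₂ m₂ → m ≤ m₁ * m₂
least-submultiplicative combine (_ , least) (p₁ , _) (p₂ , _) with combine p₁ p₂
... | m , p , m≤ = ≤-trans (least m p) m≤

module _ {A : Set} where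

  remove : ∀ {x : A} (ys : List A) → x ∈ ys → List A
  remove (y ∷ ys) (here _)  = ys
  remove (y ∷ ys) (there p) = y ∷ remove ys p

  length-remove : ∀ {x : A} (ys : List A) (p : x ∈ ys) → length ys ≡ suc (length (remove ys p))
  length-remove (y ∷ ys) (here _)  = refl
  length-remove (y ∷ ys) (there p) = cong suc (length-remove ys p)

  ∈-remove : ∀ {x z : A} (ys : List A) (p : x ∈ ys) → z ∈ ys → z ≢ x → z ∈ remove ys p
  ∈-remove (y ∷ ys) (here refl) (here refl) z≢x = ⊥-elim (z≢x refl)
  ∈-remove (y ∷ ys) (here refl) (there z∈)  _   = z∈
  ∈-remove (y ∷ ys) (there p)   (here z≡y)  _   = here z≡y
  ∈-remove (y ∷ ys) (there p)   (there z∈)  z≢x = there (∈-remove ys p z∈ z≢x)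

  Unique-⊆⇒length≤ : ∀ {xs ys : List A} → Unique xs → xs ⊆ ys → length xs ≤ length ys
  Unique-⊆⇒length≤ {[]}     _            _  = z≤n
  Unique-⊆⇒length≤ {x ∷ xs} {ys} (x∉ ∷ u) xs⊆ys =
    subst (suc (length xs) ≤_) (sym (length-remove ys x∈ys))
      (s≤s (Unique-⊆⇒length≤ u λ z∈xs → ∈-remove ys x∈ys (xs⊆ys (there z∈xs)) (λ z≡x → All.lookup x∉ z∈xs (sym z≡x))))
    where x∈ys = xs⊆ys (here refl)

  module _ (_≟_ : DecidableEquality A) where

    card-⊆ : ∀ {L M : List A} → L ⊆ M → card _≟_ L ≤ length M
    card-⊆ {L} L⊆M = Unique-⊆⇒length≤ (deduplicate-! _≟_ L) (λ z∈ → L⊆M (∈-deduplicate⁻ _≟_ L z∈))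

    Unique-⊆⇒≤card : ∀ {xs L : List A} → Unique xs → xs ⊆ L → length xs ≤ card _≟_ L
    Unique-⊆⇒≤card u xs⊆L = Unique-⊆⇒length≤ u (λ z∈ → ∈-deduplicate⁺ _≟_ (xs⊆L z∈))

Unique-map : ∀ {A B : Set} (f : A → B) {xs : List A} →
  (∀ {x y} → x ∈ xs → y ∈ xs → f x ≡ f y → x ≡ y) → Unique xs → Unique (map f xs)
Unique-map f {[]}     _   []       = []
Unique-map f {x ∷ xs} inj (x∉ ∷ u) =
  All.map⁺ (All.tabulate λ y∈ fx≡fy → All.lookup x∉ y∈ (inj (here refl) (there y∈) fx≡fy))
  ∷ Unique-map f (λ x∈ y∈ → inj (there x∈) (there y∈)) u

concatMap≡cartesianProductWith : ∀ {X Y Z : Set} (g : X → Y → Z) xs ys →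
  concatMap (λ x → map (g x) ys) xs ≡ cartesianProductWith g xs ys
concatMap≡cartesianProductWith g []       ys = refl
concatMap≡cartesianProductWith g (x ∷ xs) ys = cong (map (g x) ys ++_) (concatMap≡cartesianProductWith g xs ys)

length-cartesianProductWith : ∀ {X Y Z : Set} (g : X → Y → Z) xs ys →
  length (cartesianProductWith g xs ys) ≡ length xs * length ys
length-cartesianProductWith g []       ys = refl
length-cartesianProductWith g (x ∷ xs) ys = begin
  length (map (g x) ys ++ cartesianProductWith g xs ys)
    ≡⟨ length-++ (map (g x) ys) ⟩
  length (map (g x) ys) + length (cartesianProductWith g xs ys)
    ≡⟨ cong₂ _+_ (length-map (g x) ys) (length-cartesianProductWith g xs ys) ⟩
  length ys + length xs * length ys ∎
  where open ≡-Reasoning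

module _ {X Y Z : Set} (g : X → Y → Z) where

  card-⊆-cartesianProductWith : (_≟X_ : DecidableEquality X) (_≟Y_ : DecidableEquality Y) (_≟Z_ : DecidableEquality Z) →
    ∀ {L M₁ M₂} → L ⊆ cartesianProductWith g M₁ M₂ → card _≟Z_ L ≤ card _≟X_ M₁ * card _≟Y_ M₂
  card-⊆-cartesianProductWith _≟X_ _≟Y_ _≟Z_ {L} {M₁} {M₂} L⊆ =
    subst (card _≟Z_ L ≤_) (length-cartesianProductWith g (deduplicate _≟X_ M₁) (deduplicate _≟Y_ M₂))
      (card-⊆ _≟Z_ (λ w∈ → shrink (L⊆ w∈)))
    where
    shrink : cartesianProductWith g M₁ M₂ ⊆ cartesianProductWith g (deduplicate _≟X_ M₁) (deduplicate _≟Y_ M₂)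
    shrink w∈ with ∈-cartesianProductWith⁻ g M₁ M₂ w∈
    ... | x , y , x∈ , y∈ , refl = ∈-cartesianProductWith⁺ g (∈-deduplicate⁺ _≟X_ x∈) (∈-deduplicate⁺ _≟Y_ y∈)

  card-≥-injective : (_≟X_ : DecidableEquality X) (_≟Y_ : DecidableEquality Y) (_≟Z_ : DecidableEquality Z) →
    ∀ {M₁ M₂ L} →
    (∀ {x x' y y'} → x ∈ M₁ → x' ∈ M₁ → y ∈ M₂ → y' ∈ M₂ → g x y ≡ g x' y' → x ≡ x' × y ≡ y') →
    (∀ {x y} → x ∈ M₁ → y ∈ M₂ → g x y ∈ L) →
    card _≟X_ M₁ * card _≟Y_ M₂ ≤ card _≟Z_ L
  card-≥-injective _≟X_ _≟Y_ _≟Z_ {M₁} {M₂} {L} injective maps-into =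
    subst (_≤ card _≟Z_ L) length-image (Unique-⊆⇒≤card _≟Z_ image-unique image-⊆)
    where
    pairs = cartesianProduct (deduplicate _≟X_ M₁) (deduplicate _≟Y_ M₂)
    image = map (uncurry g) pairs
    members : ∀ {x y} → (x , y) ∈ pairs → x ∈ M₁ × y ∈ M₂
    members p∈ with ∈-cartesianProduct⁻ (deduplicate _≟X_ M₁) (deduplicate _≟Y_ M₂) p∈
    ... | x∈ , y∈ = ∈-deduplicate⁻ _≟X_ M₁ x∈ , ∈-deduplicate⁻ _≟Y_ M₂ y∈
    injective-on-pairs : ∀ {p p'} → p ∈ pairs → p' ∈ pairs → uncurry g p ≡ uncurry g p' → p ≡ p'
    injective-on-pairs {x , y} {x' , y'} p∈ p'∈ same with members p∈ | members p'∈
    ... | x∈ , y∈ | x'∈ , y'∈ with injective x∈ x'∈ y∈ y'∈ same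
    ...   | refl , refl = refl
    image-unique : Unique image
    image-unique = Unique-map (uncurry g) injective-on-pairs
      (Unique.cartesianProduct⁺ (deduplicate-! _≟X_ M₁) (deduplicate-! _≟Y_ M₂))
    image-⊆ : image ⊆ L
    image-⊆ w∈ with ∈-map⁻ (uncurry g) w∈
    ... | (x , y) , p∈ , refl with members p∈
    ...   | x∈ , y∈ = maps-into x∈ y∈
    length-image : length image ≡ card _≟X_ M₁ * card _≟Y_ M₂
    length-image = trans (length-map (uncurry g) pairs)
      (length-cartesianProductWith _,_ (deduplicate _≟X_ M₁) (deduplicate _≟Y_ M₂))

sums-suc : ∀ {X : Set} (0X : X) (_⊕_ : X → X → X) k A →
  sums 0X _⊕_ (suc k) A ≡ cartesianProductWith _⊕_ A (sums 0X _⊕_ k A)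
sums-suc 0X _⊕_ k A = concatMap≡cartesianProductWith _⊕_ A (sums 0X _⊕_ k A)

diffs-as-product : ∀ {X : Set} (_⊖_ : X → X → X) A → diffs _⊖_ A ≡ cartesianProductWith _⊖_ A A
diffs-as-product _⊖_ A = concatMap≡cartesianProductWith _⊖_ A A

module Additive {X Y Z : Set} (g : X → Y → Z) where

  _⊗_ : List X → List Y → List Z
  A ⊗ B = cartesianProductWith g A B

  module Sumsets (0X : X) (_+X_ : X → X → X) (0Y : Y) (_+Y_ : Y → Y → Y) (0Z : Z) (_+Z_ : Z → Z → Z)
                 (g-0 : g 0X 0Y ≡ 0Z) (g-+ : ∀ x x' y y' → g (x +X x') (y +Y y') ≡ g x y +Z g x' y') where

    sums-⊆ : ∀ k A B → sums 0Z _+Z_ k (A ⊗ B) ⊆ sums 0X _+X_ k A ⊗ sums 0Y _+Y_ k B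
    sums-⊆ zero A B (here refl) = here (sym g-0)
    sums-⊆ (suc k) A B w∈
      with ∈-cartesianProductWith⁻ _+Z_ (A ⊗ B) _ (subst (_ ∈_) (sums-suc 0Z _+Z_ k (A ⊗ B)) w∈)
    ... | c , s , c∈ , s∈ , refl
      with ∈-cartesianProductWith⁻ g A B c∈ | ∈-cartesianProductWith⁻ g _ _ (sums-⊆ k A B s∈)
    ... | a , b , a∈ , b∈ , refl | s₁ , s₂ , s₁∈ , s₂∈ , refl =
      subst (_∈ _) (g-+ a s₁ b s₂)
        (∈-cartesianProductWith⁺ g
          (subst (_ ∈_) (sym (sums-suc 0X _+X_ k A)) (∈-cartesianProductWith⁺ _+X_ a∈ s₁∈))
          (subst (_ ∈_) (sym (sums-suc 0Y _+Y_ k B)) (∈-cartesianProductWith⁺ _+Y_ b∈ s₂∈)))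

    card-sums-⊗ : (_≟X_ : DecidableEquality X) (_≟Y_ : DecidableEquality Y) (_≟Z_ : DecidableEquality Z) →
      ∀ k A B → card _≟Z_ (sums 0Z _+Z_ k (A ⊗ B)) ≤ card _≟X_ (sums 0X _+X_ k A) * card _≟Y_ (sums 0Y _+Y_ k B)
    card-sums-⊗ _≟X_ _≟Y_ _≟Z_ k A B = card-⊆-cartesianProductWith g _≟X_ _≟Y_ _≟Z_ {M₁ = sums 0X _+X_ k A} {M₂ = sums 0Y _+Y_ k B} (sums-⊆ k A B)

  module Differences (_-X_ : X → X → X) (_-Y_ : Y → Y → Y) (_-Z_ : Z → Z → Z)
                     (g-- : ∀ x x' y y' → g (x -X x') (y -Y y') ≡ g x y -Z g x' y') where

    diffs-⊇ : ∀ {A B d₁ d₂} → d₁ ∈ diffs _-X_ A → d₂ ∈ diffs _-Y_ B → g d₁ d₂ ∈ diffs _-Z_ (A ⊗ B)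
    diffs-⊇ {A} {B} d₁∈ d₂∈
      with ∈-cartesianProductWith⁻ _-X_ A A (subst (_ ∈_) (diffs-as-product _-X_ A) d₁∈)
         | ∈-cartesianProductWith⁻ _-Y_ B B (subst (_ ∈_) (diffs-as-product _-Y_ B) d₂∈)
    ... | x , x' , x∈ , x'∈ , refl | y , y' , y∈ , y'∈ , refl =
      subst (_ ∈_) (sym (diffs-as-product _-Z_ (A ⊗ B)))
        (subst (_∈ cartesianProductWith _-Z_ (A ⊗ B) (A ⊗ B)) (sym (g-- x x' y y'))
          (∈-cartesianProductWith⁺ _-Z_ (∈-cartesianProductWith⁺ g x∈ y∈) (∈-cartesianProductWith⁺ g x'∈ y'∈)))

additive⇒subtractive : ∀ {X Y Z : Set} (g : X → Y → Z)
  (_+X_ _-X_ : X → X → X) (_+Y_ _-Y_ : Y → Y → Y) (_+Z_ _-Z_ : Z → Z → Z) →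
  (∀ x x' → (x -X x') +X x' ≡ x) → (∀ y y' → (y -Y y') +Y y' ≡ y) → (∀ z z' → (z +Z z') -Z z' ≡ z) →
  (∀ x x' y y' → g (x +X x') (y +Y y') ≡ g x y +Z g x' y') →
  ∀ x x' y y' → g (x -X x') (y -Y y') ≡ g x y -Z g x' y'
additive⇒subtractive g _+X_ _-X_ _+Y_ _-Y_ _+Z_ _-Z_ cancelX cancelY cancelZ g-+ x x' y y' = begin
  g (x -X x') (y -Y y')                            ≡⟨ sym (cancelZ _ (g x' y')) ⟩
  (g (x -X x') (y -Y y') +Z g x' y') -Z g x' y'    ≡⟨ cong (_-Z g x' y') (sym (g-+ (x -X x') x' (y -Y y') y')) ⟩
  g ((x -X x') +X x') ((y -Y y') +Y y') -Z g x' y' ≡⟨ cong₂ (λ u v → g u v -Z g x' y') (cancelX x x') (cancelY y y') ⟩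
  g x y -Z g x' y' ∎
  where open ≡-Reasoning

linear-0 : ∀ c → + 0 ℤ.+ c ℤ.* + 0 ≡ + 0
linear-0 = ℤ-Solver.solve-∀

linear-+ : ∀ c x x' y y' → (x ℤ.+ x') ℤ.+ c ℤ.* (y ℤ.+ y') ≡ (x ℤ.+ c ℤ.* y) ℤ.+ (x' ℤ.+ c ℤ.* y')
linear-+ = ℤ-Solver.solve-∀

linear-- : ∀ c x x' y y' → (x ℤ.- x') ℤ.+ c ℤ.* (y ℤ.- y') ≡ (x ℤ.+ c ℤ.* y) ℤ.- (x' ℤ.+ c ℤ.* y')
linear-- = ℤ-Solver.solve-∀

module Linear (c : ℤ) where

  lin : ℤ → ℤ → ℤ
  lin x y = x ℤ.+ c ℤ.* y

  open Additive lin public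
  open Sumsets (+ 0) ℤ._+_ (+ 0) ℤ._+_ (+ 0) ℤ._+_ (linear-0 c) (linear-+ c) public
  open Differences ℤ._-_ ℤ._-_ ℤ._-_ (linear-- c) public

-- Base-q digits: the digit pair (r + 1, j + 1), shifted by (a₁ , a₂), lands at
-- offset 1 + r + j q from a₁ + q a₂ + q.
digit-shift : ∀ (a₁ a₂ : ℤ) (q r j : ℕ) →
  (a₁ ℤ.+ + q ℤ.* a₂ ℤ.+ + q) ℤ.+ + suc (r + j * q) ≡ (a₁ ℤ.+ + suc r) ℤ.+ + q ℤ.* (a₂ ℤ.+ + suc j)
digit-shift a₁ a₂ q r j = begin
  (a₁ ℤ.+ + q ℤ.* a₂ ℤ.+ + q) ℤ.+ + suc (r + j * q)
    ≡⟨ cong (λ t → (a₁ ℤ.+ + q ℤ.* a₂ ℤ.+ + q) ℤ.+ t) cast ⟩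
  (a₁ ℤ.+ + q ℤ.* a₂ ℤ.+ + q) ℤ.+ (+ 1 ℤ.+ (+ r ℤ.+ + j ℤ.* + q))
    ≡⟨ regroup a₁ a₂ (+ q) (+ r) (+ j) ⟩
  (a₁ ℤ.+ (+ 1 ℤ.+ + r)) ℤ.+ + q ℤ.* (a₂ ℤ.+ (+ 1 ℤ.+ + j))
    ≡⟨ cong₂ (λ u v → (a₁ ℤ.+ u) ℤ.+ + q ℤ.* (a₂ ℤ.+ v)) (sym (pos-+ 1 r)) (sym (pos-+ 1 j)) ⟩
  (a₁ ℤ.+ + suc r) ℤ.+ + q ℤ.* (a₂ ℤ.+ + suc j) ∎
  where
  open ≡-Reasoning
  cast : + suc (r + j * q) ≡ + 1 ℤ.+ (+ r ℤ.+ + j ℤ.* + q)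
  cast = begin
    + (1 + (r + j * q))             ≡⟨ pos-+ 1 (r + j * q) ⟩
    + 1 ℤ.+ + (r + j * q)           ≡⟨ cong (λ t → + 1 ℤ.+ t) (pos-+ r (j * q)) ⟩
    + 1 ℤ.+ (+ r ℤ.+ + (j * q))     ≡⟨ cong (λ t → + 1 ℤ.+ (+ r ℤ.+ t)) (pos-* j q) ⟩
    + 1 ℤ.+ (+ r ℤ.+ + j ℤ.* + q)   ∎
  regroup : ∀ a₁ a₂ q r j → (a₁ ℤ.+ q ℤ.* a₂ ℤ.+ q) ℤ.+ (+ 1 ℤ.+ (r ℤ.+ j ℤ.* q)) ≡ (a₁ ℤ.+ (+ 1 ℤ.+ r)) ℤ.+ q ℤ.* (a₂ ℤ.+ (+ 1 ℤ.+ j))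
  regroup = ℤ-Solver.solve-∀

-- Part (ii): digit pairs from two intervals of lengths q₁ and q₂ fill an
-- interval of length q₁ q₂ under (x , y) ↦ x + q₁ y.
G-product : ∀ k {q₁ q₂} .{{_ : NonZero q₁}} {m₁ m₂} → G-attains k q₁ m₁ → G-attains k q₂ m₂ →
  ∃[ m ] G-attains k (q₁ * q₂) m × m ≤ m₁ * m₂
G-product k {q₁} {q₂} (A₁ , (a₁ , interval₁) , refl) (A₂ , (a₂ , interval₂) , refl) =
  _ , (A₁ ⊗ A₂ , (a , interval) , refl) , card-sums-⊗ ℤ._≟_ ℤ._≟_ ℤ._≟_ k A₁ A₂
  where
  open Linear (+ q₁)
  a : ℤ
  a = a₁ ℤ.+ + q₁ ℤ.* a₂ ℤ.+ + q₁
  interval : ∀ i → 1 ≤ i → i ≤ q₁ * q₂ → a ℤ.+ + i ∈ diffs ℤ._-_ (A₁ ⊗ A₂)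
  interval (suc i) _ i<q₁q₂ =
    subst (λ t → a ℤ.+ + suc t ∈ diffs ℤ._-_ (A₁ ⊗ A₂)) (sym (m≡m%n+[m/n]*n i q₁))
      (subst (_∈ diffs ℤ._-_ (A₁ ⊗ A₂)) (sym (digit-shift a₁ a₂ q₁ (i % q₁) (i / q₁)))
        (diffs-⊇ {A₁} {A₂} (interval₁ (suc (i % q₁)) (s≤s z≤n) (m%n<n i q₁))
                 (interval₂ (suc (i / q₁)) (s≤s z≤n) (m<n*o⇒m/o<n (subst (i <_) (*-comm q₁ q₂) i<q₁q₂)))))

base-injective : ∀ {B M} {x x' y y' : ℤ} → ∣ x ∣ ≤ B → ∣ x' ∣ ≤ B → B + B < M →
  x ℤ.+ + M ℤ.* y ≡ x' ℤ.+ + M ℤ.* y' → x ≡ x' × y ≡ y'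
base-injective {B} {M} {x} {x'} {y} {y'} ∣x∣≤B ∣x'∣≤B 2B<M same = x≡x' , y≡y'
  where
  open ≡-Reasoning
  scaled : ∀ c x u v → c ℤ.* (u ℤ.- v) ≡ (x ℤ.+ c ℤ.* u) ℤ.- (x ℤ.+ c ℤ.* v)
  scaled = ℤ-Solver.solve-∀
  unscaled : ∀ c x x' v → (x' ℤ.+ c ℤ.* v) ℤ.- (x ℤ.+ c ℤ.* v) ≡ x' ℤ.- x
  unscaled = ℤ-Solver.solve-∀
  gap : + M ℤ.* (y ℤ.- y') ≡ x' ℤ.- x
  gap = begin
    + M ℤ.* (y ℤ.- y')                            ≡⟨ scaled (+ M) x y y' ⟩
    (x ℤ.+ + M ℤ.* y) ℤ.- (x ℤ.+ + M ℤ.* y')      ≡⟨ cong (ℤ._- (x ℤ.+ + M ℤ.* y')) same ⟩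
    (x' ℤ.+ + M ℤ.* y') ℤ.- (x ℤ.+ + M ℤ.* y')    ≡⟨ unscaled (+ M) x x' y' ⟩
    x' ℤ.- x ∎
  gap-bound : M * ∣ y ℤ.- y' ∣ ≤ B + B
  gap-bound = subst (_≤ B + B) (trans (cong ∣_∣ (sym gap)) (∣i*j∣≡∣i∣*∣j∣ (+ M) (y ℤ.- y')))
    (≤-trans (∣i-j∣≤∣i∣+∣j∣ x' x) (+-mono-≤ ∣x'∣≤B ∣x∣≤B))
  no-gap : ∀ n → M * n ≤ B + B → n ≡ 0
  no-gap zero    _ = refl
  no-gap (suc n) Mn≤2B = ⊥-elim (<⇒≱ 2B<M (≤-trans (m≤m*n M (suc n)) Mn≤2B))
  y≡y' : y ≡ y'
  y≡y' = i-j≡0⇒i≡j y y' (∣i∣≡0⇒i≡0 (no-gap _ gap-bound))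
  x≡x' : x ≡ x'
  x≡x' = ∙-cancelʳ (+ M ℤ.* y') x x' (subst (λ t → x ℤ.+ + M ℤ.* t ≡ x' ℤ.+ + M ℤ.* y') y≡y' same)

∣∣≤sum : ∀ {a : ℤ} {L : List ℤ} → a ∈ L → ∣ a ∣ ≤ sum (map ∣_∣ L)
∣∣≤sum {L = b ∷ L} (here refl) = m≤m+n ∣ b ∣ (sum (map ∣_∣ L))
∣∣≤sum {L = b ∷ L} (there a∈) = ≤-trans (∣∣≤sum a∈) (m≤n+m (sum (map ∣_∣ L)) ∣ b ∣)

-- Part (iii): with M larger than twice every |d|, d ∈ A₁ − A₁, the map
-- (x , y) ↦ x + M y is injective on (A₁ − A₁) × ℤ, so |A − A| ≥ |A₁ − A₁| · |A₂ − A₂|.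
H-product : ∀ k {q₁ q₂ m₁ m₂} → H-attains k q₁ m₁ → H-attains k q₂ m₂ →
  ∃[ m ] H-attains k (q₁ * q₂) m × m ≤ m₁ * m₂
H-product k {q₁} {q₂} (A₁ , q₁≤ , refl) (A₂ , q₂≤ , refl) =
  _ , (A₁ ⊗ A₂ , large , refl) , card-sums-⊗ ℤ._≟_ ℤ._≟_ ℤ._≟_ k A₁ A₂
  where
  B = sum (map ∣_∣ (diffs ℤ._-_ A₁))
  open Linear (+ suc (B + B))
  large : q₁ * q₂ ≤ card ℤ._≟_ (diffs ℤ._-_ (A₁ ⊗ A₂))
  large = ≤-trans (*-mono-≤ q₁≤ q₂≤)
    (card-≥-injective lin ℤ._≟_ ℤ._≟_ ℤ._≟_
      (λ x∈ x'∈ _ _ → base-injective (∣∣≤sum x∈) (∣∣≤sum x'∈) (n<1+n (B + B)))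
      (diffs-⊇ {A₁} {A₂}))

toℕ-mod : ∀ {q} .{{_ : NonZero q}} m → toℕ (m mod q) ≡ m % q
toℕ-mod m = toℕ-fromℕ< _

module Residues (n : ℕ) where
  open ZMod n

  private
    Q = suc n

  add-complement : ∀ (x : Fin Q) u v → u + v ≡ Q → ((toℕ x + u) % Q + v) % Q ≡ toℕ x
  add-complement x u v u+v≡Q = begin
    ((toℕ x + u) % Q + v) % Q          ≡⟨ %-distribˡ-+ ((toℕ x + u) % Q) v Q ⟩
    ((toℕ x + u) % Q % Q + v % Q) % Q  ≡⟨ cong (λ t → (t + v % Q) % Q) (m%n%n≡m%n (toℕ x + u) Q) ⟩
    ((toℕ x + u) % Q + v % Q) % Q      ≡⟨ sym (%-distribˡ-+ (toℕ x + u) v Q) ⟩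
    (toℕ x + u + v) % Q                ≡⟨ cong (_% Q) (trans (+-assoc (toℕ x) u v) (cong (λ w → toℕ x + w) u+v≡Q)) ⟩
    (toℕ x + Q) % Q                    ≡⟨ [m+n]%n≡m%n (toℕ x) Q ⟩
    toℕ x % Q                          ≡⟨ m<n⇒m%n≡m (toℕ<n x) ⟩
    toℕ x ∎
    where open ≡-Reasoning

  -q-+q-cancel : ∀ x y → (x -q y) +q y ≡ x
  -q-+q-cancel x y = toℕ-injective
    (trans (toℕ-mod (toℕ (x -q y) + toℕ y))
      (trans (cong (λ t → (t + toℕ y) % Q) (toℕ-mod (toℕ x + (Q ∸ toℕ y))))
        (add-complement x (Q ∸ toℕ y) (toℕ y) (m∸n+n≡m (toℕ≤n y)))))

  +q--q-cancel : ∀ x y → (x +q y) -q y ≡ x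
  +q--q-cancel x y = toℕ-injective
    (trans (toℕ-mod (toℕ (x +q y) + (Q ∸ toℕ y)))
      (trans (cong (λ t → (t + (Q ∸ toℕ y)) % Q) (toℕ-mod (toℕ x + toℕ y)))
        (add-complement x (toℕ y) (Q ∸ toℕ y) (m+[n∸m]≡n (toℕ≤n y)))))

module CRT (n₁ n₂ : ℕ) where

  q₁ q₂ : ℕ
  q₁ = suc n₁
  q₂ = suc n₂

  module Z₁ = ZMod n₁
  module Z₂ = ZMod n₂
  -- ℤ_{q₁q₂}; the index works because q₁ * q₂ reduces to suc (n₂ + n₁ * q₂).
  module Z  = ZMod (n₂ + n₁ * q₂)

  crt : Fin q₁ → Fin q₂ → Fin (q₁ * q₂)
  crt x y = (toℕ x * q₂ + toℕ y * q₁) mod (q₁ * q₂)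

  crt-reduce : ∀ W V → ((W % q₁) * q₂ + (V % q₂) * q₁) % (q₁ * q₂) ≡ (W * q₂ + V * q₁) % (q₁ * q₂)
  crt-reduce W V = begin
    ((W % q₁) * q₂ + (V % q₂) * q₁) % (q₁ * q₂)
      ≡⟨ cong₂ (λ u v → (u + v) % (q₁ * q₂)) (m%n*o≡m*o%[n*o] W q₁ q₂)
           (trans (m%n*o≡m*o%[n*o] V q₂ q₁) (%-congʳ {o = V * q₁} (*-comm q₂ q₁))) ⟩
    ((W * q₂) % (q₁ * q₂) + (V * q₁) % (q₁ * q₂)) % (q₁ * q₂)
      ≡⟨ sym (%-distribˡ-+ (W * q₂) (V * q₁) (q₁ * q₂)) ⟩
    (W * q₂ + V * q₁) % (q₁ * q₂) ∎
    where open ≡-Reasoning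

  toℕ-crt-mod : ∀ W V → toℕ (crt (W mod q₁) (V mod q₂)) ≡ (W * q₂ + V * q₁) % (q₁ * q₂)
  toℕ-crt-mod W V =
    trans (toℕ-mod (toℕ (W mod q₁) * q₂ + toℕ (V mod q₂) * q₁))
      (trans (cong₂ (λ u v → (u * q₂ + v * q₁) % (q₁ * q₂)) (toℕ-mod W) (toℕ-mod V)) (crt-reduce W V))

  crt-0 : crt Fin.zero Fin.zero ≡ Fin.zero
  crt-0 = refl

  crt-+ : ∀ x x' y y' → crt (x Z₁.+q x') (y Z₂.+q y') ≡ crt x y Z.+q crt x' y'
  crt-+ x x' y y' = toℕ-injective (begin
    toℕ (crt (x Z₁.+q x') (y Z₂.+q y'))
      ≡⟨ toℕ-crt-mod (toℕ x + toℕ x') (toℕ y + toℕ y') ⟩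
    ((toℕ x + toℕ x') * q₂ + (toℕ y + toℕ y') * q₁) % (q₁ * q₂)
      ≡⟨ cong (_% (q₁ * q₂)) (regroup (toℕ x) (toℕ x') (toℕ y) (toℕ y') q₁ q₂) ⟩
    (a + a') % (q₁ * q₂)
      ≡⟨ %-distribˡ-+ a a' (q₁ * q₂) ⟩
    (a % (q₁ * q₂) + a' % (q₁ * q₂)) % (q₁ * q₂)
      ≡⟨ sym (cong₂ (λ u v → (u + v) % (q₁ * q₂)) (toℕ-mod a) (toℕ-mod a')) ⟩
    (toℕ (crt x y) + toℕ (crt x' y')) % (q₁ * q₂)
      ≡⟨ sym (toℕ-mod (toℕ (crt x y) + toℕ (crt x' y'))) ⟩
    toℕ (crt x y Z.+q crt x' y') ∎)
    where
    open ≡-Reasoning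
    a a' : ℕ
    a  = toℕ x * q₂ + toℕ y * q₁
    a' = toℕ x' * q₂ + toℕ y' * q₁
    regroup : ∀ x x' y y' q₁ q₂ → (x + x') * q₂ + (y + y') * q₁ ≡ (x * q₂ + y * q₁) + (x' * q₂ + y' * q₁)
    regroup = ℕ-Solver.solve-∀

  crt-- : ∀ x x' y y' → crt (x Z₁.-q x') (y Z₂.-q y') ≡ crt x y Z.-q crt x' y'
  crt-- = additive⇒subtractive crt Z₁._+q_ Z₁._-q_ Z₂._+q_ Z₂._-q_ Z._+q_ Z._-q_
    (Residues.-q-+q-cancel n₁) (Residues.-q-+q-cancel n₂) (Residues.+q--q-cancel (n₂ + n₁ * q₂)) crt-+

  unit-combination : gcd q₁ q₂ ≡ 1 → ∃₂ λ s t → (s * q₂ + t * q₁) % (q₁ * q₂) ≡ 1 % (q₁ * q₂)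
  unit-combination coprime with coprime-Bézout (gcd≡1⇒coprime coprime)
  ... | Bézout.+- x y 1+yq₂≡xq₁ = y * n₁ , x , (begin
    (y * n₁ * q₂ + x * q₁) % (q₁ * q₂)       ≡⟨ cong (λ t → (y * n₁ * q₂ + t) % (q₁ * q₂)) (sym 1+yq₂≡xq₁) ⟩
    (y * n₁ * q₂ + (1 + y * q₂)) % (q₁ * q₂) ≡⟨ cong (_% (q₁ * q₂)) (rearrange y n₁ q₂) ⟩
    (1 + y * (q₁ * q₂)) % (q₁ * q₂)          ≡⟨ [m+kn]%n≡m%n 1 y (q₁ * q₂) ⟩
    1 % (q₁ * q₂) ∎)
    where
    open ≡-Reasoning
    rearrange : ∀ y n₁ q₂ → y * n₁ * q₂ + (1 + y * q₂) ≡ 1 + y * (suc n₁ * q₂)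
    rearrange = ℕ-Solver.solve-∀
  ... | Bézout.-+ x y 1+xq₁≡yq₂ = y , x * n₂ , (begin
    (y * q₂ + x * n₂ * q₁) % (q₁ * q₂)       ≡⟨ cong (λ t → (t + x * n₂ * q₁) % (q₁ * q₂)) (sym 1+xq₁≡yq₂) ⟩
    (1 + x * q₁ + x * n₂ * q₁) % (q₁ * q₂)   ≡⟨ cong (_% (q₁ * q₂)) (rearrange x n₂ q₁) ⟩
    (1 + x * (q₁ * q₂)) % (q₁ * q₂)          ≡⟨ [m+kn]%n≡m%n 1 x (q₁ * q₂) ⟩
    1 % (q₁ * q₂) ∎)
    where
    open ≡-Reasoning
    rearrange : ∀ x n₂ q₁ → 1 + x * q₁ + x * n₂ * q₁ ≡ 1 + x * (q₁ * suc n₂)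
    rearrange = ℕ-Solver.solve-∀

  crt-surjective : gcd q₁ q₂ ≡ 1 → ∀ z → ∃₂ λ x y → crt x y ≡ z
  crt-surjective coprime z with unit-combination coprime
  ... | s , t , unit = (Z * s) mod q₁ , (Z * t) mod q₂ , toℕ-injective (begin
    toℕ (crt ((Z * s) mod q₁) ((Z * t) mod q₂)) ≡⟨ toℕ-crt-mod (Z * s) (Z * t) ⟩
    (Z * s * q₂ + Z * t * q₁) % (q₁ * q₂)       ≡⟨ cong (_% (q₁ * q₂)) (factor Z s t q₁ q₂) ⟩
    (Z * (s * q₂ + t * q₁)) % (q₁ * q₂)         ≡⟨ %-distribˡ-* Z (s * q₂ + t * q₁) (q₁ * q₂) ⟩
    (Z % (q₁ * q₂) * ((s * q₂ + t * q₁) % (q₁ * q₂))) % (q₁ * q₂)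
      ≡⟨ cong (λ u → (Z % (q₁ * q₂) * u) % (q₁ * q₂)) unit ⟩
    (Z % (q₁ * q₂) * (1 % (q₁ * q₂))) % (q₁ * q₂) ≡⟨ sym (%-distribˡ-* Z 1 (q₁ * q₂)) ⟩
    (Z * 1) % (q₁ * q₂)                         ≡⟨ cong (_% (q₁ * q₂)) (*-identityʳ Z) ⟩
    Z % (q₁ * q₂)                               ≡⟨ m<n⇒m%n≡m (toℕ<n z) ⟩
    Z ∎)
    where
    open ≡-Reasoning
    Z = toℕ z
    factor : ∀ Z s t q₁ q₂ → Z * s * q₂ + Z * t * q₁ ≡ Z * (s * q₂ + t * q₁)
    factor = ℕ-Solver.solve-∀

  open Additive crt
  open Sumsets Fin.zero Z₁._+q_ Fin.zero Z₂._+q_ Fin.zero Z._+q_ crt-0 crt-+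
  open Differences Z₁._-q_ Z₂._-q_ Z._-q_ crt--

  F-product : ∀ k {m₁ m₂} → gcd q₁ q₂ ≡ 1 → F-attains k q₁ m₁ → F-attains k q₂ m₂ →
    ∃[ m ] F-attains k (q₁ * q₂) m × m ≤ m₁ * m₂
  F-product k coprime (A₁ , basis₁ , refl) (A₂ , basis₂ , refl) =
    _ , (A₁ ⊗ A₂ , basis , refl) , card-sums-⊗ Fin._≟_ Fin._≟_ Fin._≟_ k A₁ A₂
    where
    basis : ∀ z → z ∈ diffs Z._-q_ (A₁ ⊗ A₂)
    basis z = image-of (crt-surjective coprime z)
      where
      image-of : (∃₂ λ x y → crt x y ≡ z) → z ∈ diffs Z._-q_ (A₁ ⊗ A₂)
      image-of (x , y , crt-x-y≡z) = subst (_∈ diffs Z._-q_ (A₁ ⊗ A₂)) crt-x-y≡z (diffs-⊇ {A₁} {A₂} (basis₁ x) (basis₂ y))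

lemma2 : ∀ (k q₁ q₂ : ℕ) → 1 ≤ k → 2 ≤ q₁ → 2 ≤ q₂ →
    (gcd q₁ q₂ ≡ 1 → ∀ m m₁ m₂ → IsF k (q₁ * q₂) m → IsF k q₁ m₁ → IsF k q₂ m₂ → m ≤ m₁ * m₂)
    × (∀ m m₁ m₂ → IsG k (q₁ * q₂) m → IsG k q₁ m₁ → IsG k q₂ m₂ → m ≤ m₁ * m₂)
    × (∀ m m₁ m₂ → IsH k (q₁ * q₂) m → IsH k q₁ m₁ → IsH k q₂ m₂ → m ≤ m₁ * m₂)
lemma2 k (suc n₁) (suc n₂) _ _ _ =
    (λ coprime _ _ _ → least-submultiplicative (CRT.F-product n₁ n₂ k coprime))
  , (λ _ _ _ → least-submultiplicative (G-product k))
  , (λ _ _ _ → least-submultiplicative (H-product k))
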